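{- Let $\mathcal{J}_5$ be the family of all open intervals $(a,b)$ with integers $0 \le a < b \le 79$ and $b - a \in \{1,3,5\}$. Then the intersection graph of $\mathcal{J}_5$ has claw number $5$, admits a partition of its vertex set into three subsets each inducing a subgraph with claw number at most $2$, but admits no partition of its vertex set into two subsets each inducing a subgraph with claw number at most $2$.
   Context: The intersection graph of a family of sets has one vertex per set, two vertices adjacent iff the sets intersect. The claw number of a graph $G$ is the largest integer $v \ge 0$ such that the star $K_{1,v}$ is an induced subgraph of $G$. -}

module Defs where

open import Data.Nat using (ℕ; _<_; _≤_; _∸_)
open import Data.Nat.Properties using (⊔-comm)
open import Data.Fin using (Fin)
open import Data.Product using (Σ; _×_; _,_)
open import Data.Sum using (_⊎_)
open import Relation.Binary.PropositionalEquality using (_≡_; _≢_)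
open import Relation.Nullary using (¬_)
open import Function.Definitions using (Injective)

Interval : Set
Interval = ℕ × ℕ

InJ5 : Interval → Set
InJ5 (a , b) = a < b × b ≤ 79 × (b ∸ a ≡ 1 ⊎ b ∸ a ≡ 3 ⊎ b ∸ a ≡ 5)

-- Two nonempty open real intervals (a,b), (c,d) intersect iff a < d and c < b.
Intersect : Interval → Interval → Set
Intersect (a , b) (c , d) = a < d × c < b

-- Adjacency in the intersection graph (simple graph: distinct vertices).
Adj : Interval → Interval → Set
Adj u w = u ≢ w × Intersect u w

HasInducedClaw : (Interval → Set) → ℕ → Set
HasInducedClaw S v =
  Σ Interval λ c → InJ5 c × S c ×
  Σ (Fin v → Interval) λ leaf →
    ((i : Fin v) → InJ5 (leaf i) × S (leaf i) × Adj c (leaf i)) ×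
    Injective _≡_ _≡_ leaf ×
    ((i j : Fin v) → i ≢ j → ¬ Adj (leaf i) (leaf j))

ClawNumberAtMost : (Interval → Set) → ℕ → Set
ClawNumberAtMost S k = (v : ℕ) → HasInducedClaw S v → v ≤ k

ClawNumberIs : (Interval → Set) → ℕ → Set
ClawNumberIs S n = HasInducedClaw S n × ClawNumberAtMost S n

module Submission where

-- A claw centred at (a , b) has pairwise disjoint leaves, each containing a different one of the
-- b ∸ a unit cells of the centre; so the claw number is at most 5, and (0 , 5) with its five unit
-- cells attains it. Of three disjoint intervals meeting the centre, the middle one lies strictly
-- inside the centre, hence is shorter: colouring by length gives classes with claw number at
-- most 2. That two classes never suffice is a finite check: up to swapping the colours, a
-- decision tree over the intervals inside [0, 13] finds a monochromatic claw on every branch.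

open import Defs
open import Data.Empty using (⊥; ⊥-elim)
open import Data.Fin using (Fin; toℕ; fromℕ<; inject≤; opposite; _≟_)
open import Data.Fin.Patterns using (0F; 1F; 2F)
open import Data.Fin.Properties
  using (injective⇒≤; toℕ<n; toℕ-injective; fromℕ<-injective; inject≤-injective; opposite-involutive)
open import Data.List using (List; []; _∷_)
open import Data.List.Relation.Unary.All as All using (All; []; _∷_)
open import Data.Nat as ℕ using (ℕ; suc; _∸_; _≤_; _<_; _⊔_; z<s; s≤s⁻¹; _<?_; _≤?_)
open import Data.Nat.Properties hiding (_≟_)
open import Data.Product using (Σ; _×_; _,_; proj₁; proj₂)
open import Data.Product.Properties using (≡-dec)
open import Data.List.Membership.DecPropositional (≡-dec (≡-dec ℕ._≟_ ℕ._≟_) (_≟_ {2}))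
  using (_∈_; _∈?_)
open import Data.Sum using (_⊎_; inj₁; inj₂; [_,_]′)
open import Data.Unit using (⊤)
open import Function using (_∘_)
open import Function.Definitions using (Injective)
open import Relation.Binary.PropositionalEquality
open import Relation.Nullary using (¬_; Dec; yes; no)
open import Relation.Nullary.Decidable using (_×-dec_; _⊎-dec_; ¬?; from-yes; from-no)

private
  variable
    v k : ℕ
    S T : Interval → Set

Proper : Interval → Set
Proper (a , b) = a < b

length : Interval → ℕ
length (a , b) = b ∸ a

InJ5⇒Proper : ∀ {u} → InJ5 u → Proper u
InJ5⇒Proper = proj₁

Intersect-refl : ∀ {u} → Proper u → Intersect u u
Intersect-refl p = p , p

Intersect-sym : ∀ {u w} → Intersect u w → Intersect w u
Intersect-sym (p , q) = q , p

common-point⇒Intersect : ∀ {a b c d p} → a ≤ p → p < b → c ≤ p → p < d → Intersect (a , b) (c , d)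
common-point⇒Intersect a≤p p<b c≤p p<d = ≤-<-trans a≤p p<d , ≤-<-trans c≤p p<b

inJ5? : (u : Interval) → Dec (InJ5 u)
inJ5? (a , b) = a <? b ×-dec b ≤? 79 ×-dec (b ∸ a ℕ.≟ 1 ⊎-dec b ∸ a ℕ.≟ 3 ⊎-dec b ∸ a ℕ.≟ 5)

intersect? : (u w : Interval) → Dec (Intersect u w)
intersect? (a , b) (c , d) = a <? d ×-dec c <? b

pairwise-disjoint⇒injective : {leaf : Fin v → Interval} →
  (∀ i → Proper (leaf i)) → (∀ i j → i ≢ j → ¬ Intersect (leaf i) (leaf j)) →
  Injective _≡_ _≡_ leaf
pairwise-disjoint⇒injective {leaf = leaf} proper disjoint {i} {j} leafᵢ≡leafⱼ with i ≟ j
... | yes i≡j = i≡j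
... | no i≢j = ⊥-elim (disjoint i j i≢j
  (subst (Intersect (leaf i)) leafᵢ≡leafⱼ (Intersect-refl (proper i))))

nonadjacent⇒disjoint : {leaf : Fin v → Interval} → Injective _≡_ _≡_ leaf →
  (∀ i j → i ≢ j → ¬ Adj (leaf i) (leaf j)) →
  ∀ i j → i ≢ j → ¬ Intersect (leaf i) (leaf j)
nonadjacent⇒disjoint injective nonadjacent i j i≢j meet =
  nonadjacent i j i≢j ((λ eq → i≢j (injective eq)) , meet)

inducedStar : (c : Interval) (leaf : Fin v → Interval) → InJ5 c → S c →
  (∀ i → InJ5 (leaf i) × S (leaf i)) → (∀ i → c ≢ leaf i) → (∀ i → Intersect c (leaf i)) →
  (∀ i j → i ≢ j → ¬ Intersect (leaf i) (leaf j)) → HasInducedClaw S v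
inducedStar c leaf c∈J5 Sc leaves c≢leaf meet disjoint =
  c , c∈J5 , Sc , leaf ,
  (λ i → proj₁ (leaves i) , proj₂ (leaves i) , c≢leaf i , meet i) ,
  pairwise-disjoint⇒injective (InJ5⇒Proper ∘ proj₁ ∘ leaves) disjoint ,
  (λ i j i≢j → disjoint i j i≢j ∘ proj₂)

HasInducedClaw-mono : (∀ {u} → S u → T u) → HasInducedClaw S v → HasInducedClaw T v
HasInducedClaw-mono S⊆T (c , c∈J5 , Sc , leaf , leaves , injective , nonadjacent) =
  c , c∈J5 , S⊆T Sc , leaf ,
  (λ i → let (leaf∈J5 , S-leaf , adj) = leaves i in leaf∈J5 , S⊆T S-leaf , adj) ,
  injective , nonadjacent

HasInducedClaw-≤ : ∀ {w} → w ≤ v → HasInducedClaw S v → HasInducedClaw S w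
HasInducedClaw-≤ w≤v (c , c∈J5 , Sc , leaf , leaves , injective , nonadjacent) =
  c , c∈J5 , Sc , leaf ∘ restrict , leaves ∘ restrict ,
  (λ eq → inject≤-injective w≤v w≤v _ _ (injective eq)) ,
  (λ i j i≢j → nonadjacent (restrict i) (restrict j)
                 (i≢j ∘ inject≤-injective w≤v w≤v _ _))
  where
  restrict : Fin _ → Fin _
  restrict i = inject≤ i w≤v

no-claw⇒ClawNumberAtMost : ¬ HasInducedClaw S (suc k) → ClawNumberAtMost S k
no-claw⇒ClawNumberAtMost {k = k} no-claw v claw with v ≤? k
... | yes v≤k = v≤k
... | no v≰k = ⊥-elim (no-claw (HasInducedClaw-≤ (≰⇒> v≰k) claw))

ClawNumberAtMost-anti : (∀ {u} → T u → S u) → ClawNumberAtMost S k → ClawNumberAtMost T k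
ClawNumberAtMost-anti T⊆S atMost v = atMost v ∘ HasInducedClaw-mono T⊆S

-- Claw number of J₅

unit : ℕ → Interval
unit n = n , suc n

unit∈J5 : ∀ {n} → suc n ≤ 79 → InJ5 (unit n)
unit∈J5 {n} bound = n<1+n n , bound , inj₁ (m+n∸n≡m 1 n)

units-intersect⇒≡ : ∀ {m n} → Intersect (unit m) (unit n) → m ≡ n
units-intersect⇒≡ (m<1+n , n<1+m) = ≤-antisym (s≤s⁻¹ m<1+n) (s≤s⁻¹ n<1+m)

claw-of-five-units : HasInducedClaw (λ _ → ⊤) 5
claw-of-five-units =
  inducedStar (0 , 5) (unit ∘ toℕ) (from-yes (inJ5? (0 , 5))) _
    (λ i → unit∈J5 (≤-trans (toℕ<n i) (m≤m+n 5 74)) , _)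
    (λ i eq → 5≢1 (trans (cong length eq) (m+n∸n≡m 1 (toℕ i))))
    (λ i → z<s , toℕ<n i)
    (λ i j i≢j → i≢j ∘ toℕ-injective ∘ units-intersect⇒≡)
  where
  5≢1 : 5 ≢ 1
  5≢1 ()

disjoint-meeting≤length : ∀ c (leaf : Fin v → Interval) → Proper c → (∀ i → Proper (leaf i)) →
  (∀ i → Intersect c (leaf i)) → (∀ i j → i ≢ j → ¬ Intersect (leaf i) (leaf j)) →
  v ≤ length c
disjoint-meeting≤length (a , b) leaf a<b proper meet disjoint =
  injective⇒≤ cell-injective
  where
  point : Fin _ → ℕ
  point i = a ⊔ proj₁ (leaf i)
  point<b : ∀ i → point i < b
  point<b i = ⊔-lub a<b (proj₂ (meet i))
  point∈leaf : ∀ i → proj₁ (leaf i) ≤ point i × point i < proj₂ (leaf i)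
  point∈leaf i = m≤n⊔m a _ , ⊔-lub (proj₁ (meet i)) (proper i)
  cell : Fin _ → Fin (b ∸ a)
  cell i = fromℕ< (∸-monoˡ-< (point<b i) (m≤m⊔n a _))
  cell-injective : Injective _≡_ _≡_ cell
  cell-injective {i} {j} cellᵢ≡cellⱼ with i ≟ j
  ... | yes i≡j = i≡j
  ... | no i≢j = ⊥-elim (disjoint i j i≢j (common-point⇒Intersect
          (proj₁ (point∈leaf i)) (proj₂ (point∈leaf i))
          (subst (proj₁ (leaf j) ≤_) (sym pointᵢ≡pointⱼ) (proj₁ (point∈leaf j)))
          (subst (_< proj₂ (leaf j)) (sym pointᵢ≡pointⱼ) (proj₂ (point∈leaf j)))))
    where
    pointᵢ≡pointⱼ : point i ≡ point j
    pointᵢ≡pointⱼ = ∸-cancelʳ-≡ (m≤m⊔n a _) (m≤m⊔n a _) (fromℕ<-injective _ _ _ _ cellᵢ≡cellⱼ)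

AdmissibleLength : ℕ → Set
AdmissibleLength n = n ≡ 1 ⊎ n ≡ 3 ⊎ n ≡ 5

admissibleLength≤5 : ∀ {n} → AdmissibleLength n → n ≤ 5
admissibleLength≤5 (inj₁ refl) = from-yes (1 ≤? 5)
admissibleLength≤5 (inj₂ (inj₁ refl)) = from-yes (3 ≤? 5)
admissibleLength≤5 (inj₂ (inj₂ refl)) = ≤-refl

clawNumber≤5 : ClawNumberAtMost S 5
clawNumber≤5 v (c , c∈J5 , _ , leaf , leaves , injective , nonadjacent) =
  ≤-trans
    (disjoint-meeting≤length c leaf (InJ5⇒Proper c∈J5)
      (InJ5⇒Proper ∘ proj₁ ∘ leaves) (proj₂ ∘ proj₂ ∘ proj₂ ∘ leaves)
      (nonadjacent⇒disjoint injective nonadjacent))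
    (admissibleLength≤5 (proj₂ (proj₂ c∈J5)))

-- Colouring by length

Precedes : Interval → Interval → Set
Precedes (_ , b) (c , _) = b ≤ c

disjoint⇒precedes : ∀ u w → ¬ Intersect u w → Precedes u w ⊎ Precedes w u
disjoint⇒precedes (a , b) (c , d) disjoint with a <? d
... | yes a<d = inj₁ (≮⇒≥ (λ c<b → disjoint (a<d , c<b)))
... | no a≮d = inj₂ (≮⇒≥ a≮d)

precedes-acyclic : ∀ x y z → Proper x → Proper y → Proper z →
  Precedes x y → Precedes y z → ¬ Precedes z x
precedes-acyclic (a , b) (c , d) (e , f) a<b c<d e<f b≤c d≤e f≤a =
  <-irrefl refl (begin-strict
    a <⟨ a<b ⟩ b ≤⟨ b≤c ⟩ c <⟨ c<d ⟩ d ≤⟨ d≤e ⟩ e <⟨ e<f ⟩ f ≤⟨ f≤a ⟩ a ∎)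
  where open ≤-Reasoning

between⇒shorter : ∀ c x y z → Proper y → Intersect c x → Intersect c z →
  Precedes x y → Precedes y z → length y < length c
between⇒shorter (p , q) (a , b) (r , s) (e , f) r<s (p<b , _) (_ , e<q) b≤r s≤e =
  <-≤-trans (∸-monoˡ-< (≤-<-trans s≤e e<q) (<⇒≤ r<s)) (∸-monoʳ-≤ q (<⇒≤ (<-≤-trans p<b b≤r)))

three-disjoint⇒shorter : ∀ c x y z → Proper x → Proper y → Proper z →
  Intersect c x → Intersect c y → Intersect c z →
  ¬ Intersect x y → ¬ Intersect x z → ¬ Intersect y z →
  length x < length c ⊎ length y < length c ⊎ length z < length c
three-disjoint⇒shorter c x y z px py pz cx cy cz x∤y x∤z y∤z
  with disjoint⇒precedes x y x∤y | disjoint⇒precedes x z x∤z | disjoint⇒precedes y z y∤z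
... | inj₁ x<y | inj₁ x<z | inj₁ y<z = inj₂ (inj₁ (between⇒shorter c x y z py cx cz x<y y<z))
... | inj₁ x<y | inj₁ x<z | inj₂ z<y = inj₂ (inj₂ (between⇒shorter c x z y pz cx cy x<z z<y))
... | inj₁ x<y | inj₂ z<x | inj₁ y<z = ⊥-elim (precedes-acyclic x y z px py pz x<y y<z z<x)
... | inj₁ x<y | inj₂ z<x | inj₂ z<y = inj₁ (between⇒shorter c z x y px cz cy z<x x<y)
... | inj₂ y<x | inj₁ x<z | inj₁ y<z = inj₁ (between⇒shorter c y x z px cy cz y<x x<z)
... | inj₂ y<x | inj₁ x<z | inj₂ z<y = ⊥-elim (precedes-acyclic y x z py px pz y<x x<z z<y)
... | inj₂ y<x | inj₂ z<x | inj₁ y<z = inj₂ (inj₂ (between⇒shorter c y z x pz cy cx y<z z<x))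
... | inj₂ y<x | inj₂ z<x | inj₂ z<y = inj₂ (inj₁ (between⇒shorter c z y x py cz cx z<y y<x))

lengthClassOf : ℕ → Fin 3
lengthClassOf 1 = 0F
lengthClassOf 3 = 1F
lengthClassOf _ = 2F

lengthClassOf-injective : ∀ {m n} → AdmissibleLength m → AdmissibleLength n →
  lengthClassOf m ≡ lengthClassOf n → m ≡ n
lengthClassOf-injective (inj₁ refl) (inj₁ refl) _ = refl
lengthClassOf-injective (inj₂ (inj₁ refl)) (inj₂ (inj₁ refl)) _ = refl
lengthClassOf-injective (inj₂ (inj₂ refl)) (inj₂ (inj₂ refl)) _ = refl
lengthClassOf-injective (inj₁ refl) (inj₂ (inj₁ refl)) ()
lengthClassOf-injective (inj₁ refl) (inj₂ (inj₂ refl)) ()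
lengthClassOf-injective (inj₂ (inj₁ refl)) (inj₁ refl) ()
lengthClassOf-injective (inj₂ (inj₁ refl)) (inj₂ (inj₂ refl)) ()
lengthClassOf-injective (inj₂ (inj₂ refl)) (inj₁ refl) ()
lengthClassOf-injective (inj₂ (inj₂ refl)) (inj₂ (inj₁ refl)) ()

lengthClass : Interval → Fin 3
lengthClass = lengthClassOf ∘ length

lengthClass-no-claw : ∀ i → ¬ HasInducedClaw (λ u → lengthClass u ≡ i) 3
lengthClass-no-claw i (c , c∈J5 , cᵢ , leaf , leaves , injective , nonadjacent) =
  [ <-irrefl (sameLength 0F) , [ <-irrefl (sameLength 1F) , <-irrefl (sameLength 2F) ]′ ]′
    (three-disjoint⇒shorter c (leaf 0F) (leaf 1F) (leaf 2F)
      (proper 0F) (proper 1F) (proper 2F) (meet 0F) (meet 1F) (meet 2F)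
      (disjoint 0F 1F λ ()) (disjoint 0F 2F λ ()) (disjoint 1F 2F λ ()))
  where
  proper : ∀ k → Proper (leaf k)
  proper = InJ5⇒Proper ∘ proj₁ ∘ leaves
  meet : ∀ k → Intersect c (leaf k)
  meet = proj₂ ∘ proj₂ ∘ proj₂ ∘ leaves
  disjoint : ∀ k l → k ≢ l → ¬ Intersect (leaf k) (leaf l)
  disjoint = nonadjacent⇒disjoint injective nonadjacent
  sameLength : ∀ k → length (leaf k) ≡ length c
  sameLength k = lengthClassOf-injective (proj₂ (proj₂ (proj₁ (leaves k)))) (proj₂ (proj₂ c∈J5))
    (trans (proj₁ (proj₂ (leaves k))) (sym cᵢ))

-- No partition into two classes of claw number at most 2

IsClaw : Interval → Interval → Interval → Interval → Set
IsClaw c x y z =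
  All InJ5 (c ∷ x ∷ y ∷ z ∷ []) × Intersect c x × Intersect c y × Intersect c z ×
  ¬ Intersect x y × ¬ Intersect x z × ¬ Intersect y z

isClaw? : ∀ c x y z → Dec (IsClaw c x y z)
isClaw? c x y z =
  All.all? inJ5? _ ×-dec intersect? c x ×-dec intersect? c y ×-dec intersect? c z ×-dec
  ¬? (intersect? x y) ×-dec ¬? (intersect? x z) ×-dec ¬? (intersect? y z)

IsClaw⇒HasInducedClaw : ∀ {c x y z} → IsClaw c x y z → All S (c ∷ x ∷ y ∷ z ∷ []) →
  HasInducedClaw S 3
IsClaw⇒HasInducedClaw {S = S} {c} {x} {y} {z}
  (c∈J5 ∷ x∈J5 ∷ y∈J5 ∷ z∈J5 ∷ [] , cx , cy , cz , x∤y , x∤z , y∤z) (Sc ∷ Sx ∷ Sy ∷ Sz ∷ []) =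
  inducedStar c leaf c∈J5 Sc leaves c≢leaf meet disjoint
  where
  leaf : Fin 3 → Interval
  leaf 0F = x
  leaf 1F = y
  leaf 2F = z
  leaves : ∀ i → InJ5 (leaf i) × S (leaf i)
  leaves 0F = x∈J5 , Sx
  leaves 1F = y∈J5 , Sy
  leaves 2F = z∈J5 , Sz
  meet : ∀ i → Intersect c (leaf i)
  meet 0F = cx
  meet 1F = cy
  meet 2F = cz
  c≢leaf : ∀ i → c ≢ leaf i
  c≢leaf 0F c≡x = x∤y (subst (λ w → Intersect w y) c≡x cy)
  c≢leaf 1F c≡y = x∤y (Intersect-sym (subst (λ w → Intersect w x) c≡y cx))
  c≢leaf 2F c≡z = x∤z (Intersect-sym (subst (λ w → Intersect w x) c≡z cx))
  disjoint : ∀ i j → i ≢ j → ¬ Intersect (leaf i) (leaf j)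
  disjoint 0F 0F i≢j = ⊥-elim (i≢j refl)
  disjoint 0F 1F _ = x∤y
  disjoint 0F 2F _ = x∤z
  disjoint 1F 0F _ = x∤y ∘ Intersect-sym
  disjoint 1F 1F i≢j = ⊥-elim (i≢j refl)
  disjoint 1F 2F _ = y∤z
  disjoint 2F 0F _ = x∤z ∘ Intersect-sym
  disjoint 2F 1F _ = y∤z ∘ Intersect-sym
  disjoint 2F 2F i≢j = ⊥-elim (i≢j refl)

PartialColouring : Set
PartialColouring = List (Interval × Fin 2)

Extends : (Interval → Fin 2) → PartialColouring → Set
Extends f = All λ (u , i) → f u ≡ i

data Refutation : Set where
  claw  : Fin 2 → (c x y z : Interval) → Refutation
  split : Interval → Refutation → Refutation → Refutation

Refutes : PartialColouring → Refutation → Set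
Refutes σ (claw i c x y z) = IsClaw c x y z × All (λ u → (u , i) ∈ σ) (c ∷ x ∷ y ∷ z ∷ [])
Refutes σ (split u t₀ t₁) = Refutes ((u , 0F) ∷ σ) t₀ × Refutes ((u , 1F) ∷ σ) t₁

refutes? : ∀ σ t → Dec (Refutes σ t)
refutes? σ (claw i c x y z) = isClaw? c x y z ×-dec All.all? (λ u → (u , i) ∈? σ) _
refutes? σ (split u t₀ t₁) = refutes? _ t₀ ×-dec refutes? _ t₁

ClassesClawNumberAtMost : ∀ {n} → (Interval → Fin n) → ℕ → Set
ClassesClawNumberAtMost f k = ∀ i → ClawNumberAtMost (λ u → f u ≡ i) k

refutation-sound : ∀ {f σ} t → ClassesClawNumberAtMost f 2 → Extends f σ → Refutes σ t → ⊥
refutation-sound (claw i c x y z) atMost₂ f⊇σ (isClaw , coloured) =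
  from-no (3 ≤? 2) (atMost₂ i 3 (IsClaw⇒HasInducedClaw isClaw (All.map (All.lookup f⊇σ) coloured)))
refutation-sound {f} (split u t₀ t₁) atMost₂ f⊇σ (refutes₀ , refutes₁) with f u in fu≡
... | 0F = refutation-sound t₀ atMost₂ (fu≡ ∷ f⊇σ) refutes₀
... | 1F = refutation-sound t₁ atMost₂ (fu≡ ∷ f⊇σ) refutes₁

opposite-classes : ∀ {f : Interval → Fin 2} →
  ClassesClawNumberAtMost f k → ClassesClawNumberAtMost (opposite ∘ f) k
opposite-classes {f = f} atMost i =
  ClawNumberAtMost-anti
    (λ {u} fu≡ → trans (sym (opposite-involutive (f u))) (cong opposite fu≡))
    (atMost (opposite i))

certificate : Refutation
certificate =
  split (5 , 6)
    (split (7 , 8)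
      (split (5 , 8)
        (claw 0F (5 , 8) (5 , 6) (6 , 7) (7 , 8))
        (split (3 , 8)
          (claw 0F (3 , 8) (5 , 6) (6 , 7) (7 , 8))
          (split (4 , 9)
            (claw 0F (4 , 9) (5 , 6) (6 , 7) (7 , 8))
            (split (5 , 10)
              (claw 0F (5 , 10) (5 , 6) (6 , 7) (7 , 8))
              (split (2 , 7)
                (split (3 , 4)
                  (claw 0F (2 , 7) (3 , 4) (5 , 6) (6 , 7))
                  (split (4 , 5)
                    (claw 0F (2 , 7) (4 , 5) (5 , 6) (6 , 7))
                    (claw 1F (3 , 8) (3 , 4) (4 , 5) (5 , 8))))
                (split (4 , 5)
                  (split (4 , 7)
                    (claw 0F (4 , 7) (4 , 5) (5 , 6) (6 , 7))
                    (split (3 , 4)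
                      (split (3 , 6)
                        (claw 0F (3 , 6) (3 , 4) (4 , 5) (5 , 6))
                        (split (1 , 6)
                          (claw 0F (1 , 6) (3 , 4) (4 , 5) (5 , 6))
                          (split (8 , 9)
                            (split (6 , 9)
                              (claw 0F (6 , 9) (6 , 7) (7 , 8) (8 , 9))
                              (split (9 , 10)
                                (split (7 , 10)
                                  (claw 0F (7 , 10) (7 , 8) (8 , 9) (9 , 10))
                                  (split (2 , 3)
                                    (split (2 , 5)
                                      (claw 0F (2 , 5) (2 , 3) (3 , 4) (4 , 5))
                                      (split (1 , 2)
                                        (split (1 , 4)
                                          (claw 0F (1 , 4) (1 , 2) (2 , 3) (3 , 4))
                                          (claw 1F (3 , 8) (1 , 4) (4 , 7) (7 , 10)))
                                        (claw 1F (1 , 6) (1 , 2) (2 , 5) (5 , 8))))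
                                    (claw 1F (2 , 7) (2 , 3) (3 , 6) (6 , 9))))
                                (claw 1F (5 , 10) (3 , 6) (6 , 9) (9 , 10))))
                            (split (0 , 5)
                              (split (1 , 2)
                                (claw 0F (0 , 5) (1 , 2) (3 , 4) (4 , 5))
                                (split (2 , 3)
                                  (claw 0F (0 , 5) (2 , 3) (3 , 4) (4 , 5))
                                  (claw 1F (1 , 6) (1 , 2) (2 , 3) (3 , 6))))
                              (claw 1F (4 , 9) (0 , 5) (5 , 8) (8 , 9))))))
                      (split (2 , 3)
                        (split (1 , 6)
                          (claw 0F (1 , 6) (2 , 3) (4 , 5) (5 , 6))
                          (split (1 , 2)
                            (split (0 , 5)
                              (claw 0F (0 , 5) (1 , 2) (2 , 3) (4 , 5))
                              (split (0 , 1)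
                                (split (0 , 3)
                                  (claw 0F (0 , 3) (0 , 1) (1 , 2) (2 , 3))
                                  (claw 1F (0 , 5) (0 , 3) (3 , 4) (4 , 7)))
                                (claw 1F (0 , 5) (0 , 1) (3 , 4) (4 , 7))))
                            (claw 1F (1 , 6) (1 , 2) (3 , 4) (4 , 7))))
                        (claw 1F (2 , 7) (2 , 3) (3 , 4) (4 , 7)))))
                  (split (2 , 3)
                    (split (3 , 4)
                      (split (1 , 6)
                        (claw 0F (1 , 6) (2 , 3) (3 , 4) (5 , 6))
                        (split (1 , 2)
                          (split (1 , 4)
                            (claw 0F (1 , 4) (1 , 2) (2 , 3) (3 , 4))
                            (claw 1F (1 , 6) (1 , 4) (4 , 5) (5 , 8)))
                          (claw 1F (1 , 6) (1 , 2) (4 , 5) (5 , 8))))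
                      (claw 1F (2 , 7) (3 , 4) (4 , 5) (5 , 8)))
                    (claw 1F (2 , 7) (2 , 3) (4 , 5) (5 , 8)))))))))
      (split (2 , 7)
        (split (2 , 3)
          (claw 0F (2 , 7) (2 , 3) (5 , 6) (6 , 7))
          (split (3 , 4)
            (claw 0F (2 , 7) (3 , 4) (5 , 6) (6 , 7))
            (split (4 , 5)
              (claw 0F (2 , 7) (4 , 5) (5 , 6) (6 , 7))
              (split (2 , 5)
                (claw 0F (2 , 7) (2 , 5) (5 , 6) (6 , 7))
                (claw 1F (2 , 5) (2 , 3) (3 , 4) (4 , 5))))))
        (split (5 , 10)
          (split (8 , 9)
            (claw 0F (5 , 10) (5 , 6) (6 , 7) (8 , 9))
            (split (9 , 10)
              (claw 0F (5 , 10) (5 , 6) (6 , 7) (9 , 10))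
              (split (7 , 10)
                (claw 0F (5 , 10) (5 , 6) (6 , 7) (7 , 10))
                (claw 1F (7 , 10) (7 , 8) (8 , 9) (9 , 10)))))
          (split (8 , 9)
            (split (4 , 9)
              (claw 0F (4 , 9) (5 , 6) (6 , 7) (8 , 9))
              (split (8 , 11)
                (split (8 , 13)
                  (split (9 , 10)
                    (split (10 , 11)
                      (claw 0F (8 , 11) (8 , 9) (9 , 10) (10 , 11))
                      (split (6 , 11)
                        (claw 0F (6 , 11) (6 , 7) (8 , 9) (9 , 10))
                        (claw 1F (6 , 11) (2 , 7) (7 , 8) (10 , 11))))
                    (claw 1F (5 , 10) (2 , 7) (7 , 8) (9 , 10)))
                  (claw 1F (4 , 9) (2 , 7) (7 , 8) (8 , 13)))
                (claw 1F (4 , 9) (2 , 7) (7 , 8) (8 , 11))))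
            (claw 1F (5 , 10) (2 , 7) (7 , 8) (8 , 9))))))
    (split (7 , 8)
      (split (6 , 11)
        (split (8 , 9)
          (claw 0F (6 , 11) (6 , 7) (7 , 8) (8 , 9))
          (split (9 , 10)
            (claw 0F (6 , 11) (6 , 7) (7 , 8) (9 , 10))
            (split (10 , 11)
              (claw 0F (6 , 11) (6 , 7) (7 , 8) (10 , 11))
              (split (8 , 11)
                (claw 0F (6 , 11) (6 , 7) (7 , 8) (8 , 11))
                (claw 1F (8 , 11) (8 , 9) (9 , 10) (10 , 11))))))
        (split (3 , 8)
          (split (3 , 4)
            (claw 0F (3 , 8) (3 , 4) (6 , 7) (7 , 8))
            (split (4 , 5)
              (claw 0F (3 , 8) (4 , 5) (6 , 7) (7 , 8))
              (split (3 , 6)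
                (claw 0F (3 , 8) (3 , 6) (6 , 7) (7 , 8))
                (claw 1F (3 , 6) (3 , 4) (4 , 5) (5 , 6)))))
          (split (3 , 4)
            (split (4 , 5)
              (split (2 , 7)
                (claw 0F (2 , 7) (3 , 4) (4 , 5) (6 , 7))
                (split (2 , 3)
                  (split (2 , 5)
                    (claw 0F (2 , 5) (2 , 3) (3 , 4) (4 , 5))
                    (claw 1F (2 , 7) (2 , 5) (5 , 6) (6 , 11)))
                  (claw 1F (2 , 7) (2 , 3) (5 , 6) (6 , 11))))
              (claw 1F (3 , 8) (4 , 5) (5 , 6) (6 , 11)))
            (claw 1F (3 , 8) (3 , 4) (5 , 6) (6 , 11)))))
      (split (4 , 9)
        (split (8 , 9)
          (split (4 , 5)
            (claw 0F (4 , 9) (4 , 5) (6 , 7) (8 , 9))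
            (split (3 , 8)
              (split (2 , 5)
                (claw 0F (4 , 9) (2 , 5) (6 , 7) (8 , 9))
                (split (1 , 6)
                  (claw 0F (4 , 9) (1 , 6) (6 , 7) (8 , 9))
                  (split (1 , 2)
                    (split (2 , 3)
                      (split (1 , 4)
                        (claw 0F (1 , 4) (1 , 2) (2 , 3) (3 , 8))
                        (claw 1F (1 , 6) (1 , 4) (4 , 5) (5 , 6)))
                      (claw 1F (1 , 6) (2 , 3) (4 , 5) (5 , 6)))
                    (claw 1F (1 , 6) (1 , 2) (4 , 5) (5 , 6)))))
              (claw 1F (3 , 8) (4 , 5) (5 , 6) (7 , 8))))
          (split (5 , 10)
            (split (7 , 12)
              (split (4 , 5)
                (claw 0F (4 , 9) (4 , 5) (6 , 7) (7 , 12))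
                (split (3 , 8)
                  (split (3 , 4)
                    (claw 0F (3 , 8) (3 , 4) (6 , 7) (7 , 12))
                    (split (3 , 6)
                      (claw 0F (3 , 8) (3 , 6) (6 , 7) (7 , 12))
                      (claw 1F (3 , 6) (3 , 4) (4 , 5) (5 , 6))))
                  (claw 1F (3 , 8) (4 , 5) (5 , 6) (7 , 8))))
              (split (10 , 11)
                (split (11 , 12)
                  (split (9 , 12)
                    (claw 0F (9 , 12) (5 , 10) (10 , 11) (11 , 12))
                    (claw 1F (7 , 12) (7 , 8) (8 , 9) (9 , 12)))
                  (claw 1F (7 , 12) (7 , 8) (8 , 9) (11 , 12)))
                (claw 1F (7 , 12) (7 , 8) (8 , 9) (10 , 11))))
            (claw 1F (5 , 10) (5 , 6) (7 , 8) (8 , 9))))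
        (split (4 , 5)
          (split (8 , 9)
            (split (2 , 5)
              (split (8 , 11)
                (split (0 , 5)
                  (split (8 , 13)
                    (split (9 , 10)
                      (split (10 , 11)
                        (claw 0F (8 , 11) (8 , 9) (9 , 10) (10 , 11))
                        (split (10 , 13)
                          (claw 0F (8 , 11) (8 , 9) (9 , 10) (10 , 13))
                          (split (11 , 12)
                            (claw 0F (8 , 13) (8 , 9) (9 , 10) (11 , 12))
                            (split (12 , 13)
                              (claw 0F (8 , 13) (8 , 9) (9 , 10) (12 , 13))
                              (claw 1F (10 , 13) (10 , 11) (11 , 12) (12 , 13))))))
                      (split (5 , 10)
                        (split (3 , 6)
                          (claw 0F (5 , 10) (3 , 6) (6 , 7) (8 , 9))
                          (split (9 , 12)
                            (claw 0F (5 , 10) (6 , 7) (8 , 9) (9 , 12))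
                            (split (1 , 6)
                              (claw 0F (5 , 10) (1 , 6) (6 , 7) (8 , 9))
                              (split (3 , 4)
                                (split (2 , 3)
                                  (claw 0F (2 , 5) (2 , 3) (3 , 4) (4 , 5))
                                  (split (1 , 2)
                                    (claw 0F (0 , 5) (1 , 2) (3 , 4) (4 , 5))
                                    (claw 1F (1 , 6) (1 , 2) (2 , 3) (5 , 6))))
                                (split (1 , 2)
                                  (split (2 , 3)
                                    (claw 0F (0 , 5) (1 , 2) (2 , 3) (4 , 5))
                                    (claw 1F (1 , 6) (2 , 3) (3 , 4) (5 , 6)))
                                  (claw 1F (1 , 6) (1 , 2) (3 , 4) (5 , 6)))))))
                        (claw 1F (5 , 10) (5 , 6) (7 , 8) (9 , 10))))
                    (claw 1F (4 , 9) (5 , 6) (7 , 8) (8 , 13)))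
                  (claw 1F (4 , 9) (0 , 5) (5 , 6) (7 , 8)))
                (claw 1F (4 , 9) (5 , 6) (7 , 8) (8 , 11)))
              (claw 1F (4 , 9) (2 , 5) (5 , 6) (7 , 8)))
            (claw 1F (4 , 9) (5 , 6) (7 , 8) (8 , 9)))
          (claw 1F (4 , 9) (4 , 5) (5 , 6) (7 , 8)))))

certificate-valid : Refutes (((6 , 7) , 0F) ∷ []) certificate
certificate-valid = from-yes (refutes? (((6 , 7) , 0F) ∷ []) certificate)

no-two-classes-clawNumber≤2 : ¬ Σ (Interval → Fin 2) λ f → ClassesClawNumberAtMost f 2
no-two-classes-clawNumber≤2 (f , atMost₂) with f (6 , 7) in f67≡
... | 0F = refutation-sound certificate atMost₂ (f67≡ ∷ []) certificate-valid
... | 1F = refutation-sound certificate (opposite-classes atMost₂) (cong opposite f67≡ ∷ [])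
             certificate-valid

lemma6 : ClawNumberIs (λ _ → ⊤) 5
         × Σ (Interval → Fin 3) (λ f → (i : Fin 3) → ClawNumberAtMost (λ u → f u ≡ i) 2)
         × ¬ Σ (Interval → Fin 2) (λ f → (i : Fin 2) → ClawNumberAtMost (λ u → f u ≡ i) 2)
lemma6 =
  (claw-of-five-units , clawNumber≤5) ,
  (lengthClass , no-claw⇒ClawNumberAtMost ∘ lengthClass-no-claw) ,
  no-two-classes-clawNumber≤2
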